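{- For every $(u'',\ell',y)\in B_{m-1,n-1}\times B_{m-1,n}\times\mathbb{Z}^2$ with $y=(y_1,y_2)$, $$\rho\big(\beta\big(M(u'',\ell',(y_1,y_2))\big)\big)=M\big(\rho(u''),\rho(\ell'),(-y_1,-y_2)\big).$$
   Context: $m,n$ positive integers. $B_{p,q}$: words over $\{N,E\}$ with $p$ letters $E$ and $q$ letters $N$, read as lattice paths ($N=(0,1)$, $E=(1,0)$). For $w\in B_{p,q}$, $w^{\mathbb{Z}}$ is the concatenation over $i\in\mathbb{Z}$ of the paths from $(pi,qi)$ with steps $w$. Let $R=(Nu'')^{\mathbb{Z}}$, $G=(E\ell')^{\mathbb{Z}}$. $N_i$ is the unique north step of $G$ starting at ordinate $i$, $X_1(N_i)$ the abscissa of its start; $E_j$ is the unique east step of $R$ starting at abscissa $j$, $X_2(E_j)$ the ordinate of its start. $M(u'',\ell',y)=(c_1,\dots,c_{n+m-1})$ with $c_{i+1}=X_1(N_{y_2+i})-y_1-1$ ($0\le i\le n-1$) and $c_{n+1+j}=X_2(E_{y_1+j})-y_2-1$ ($0\le j\le m-2$). For a word $w=w_1\cdots w_k$, $\rho(w)=w_k\cdots w_1$. For a configuration $c=(c_1,\dots,c_{n+m-1})$ on $K_{m,n}$, $\beta(c)=(m-1-c_1,\dots,m-1-c_n,n-1-c_{n+1},\dots,n-1-c_{n+m-1})$ and $\rho(c)=(c_n,c_{n-1},\dots,c_1,c_{n+m-1},\dots,c_{n+1})$ (reversal within each of the two blocks). -}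

module Defs where

open import Data.Nat as ℕ using (ℕ; zero; suc; _∸_)
open import Data.Integer as ℤ using (ℤ; +_; _+_; _-_; _*_; -_; _/ℕ_; _%ℕ_)
open import Data.List as List using (List; []; _∷_)
open import Data.Vec as Vec using (Vec)
open import Data.Fin using (Fin; toℕ)
open import Data.Product using (_×_; _,_)

-- Letters of lattice words: N = (0,1), E = (1,0).
data Step : Set where
  N E : Step

Word : Set
Word = List Step

countE : Word → ℕ
countE []      = 0
countE (E ∷ w) = suc (countE w)
countE (N ∷ w) = countE w

countN : Word → ℕ
countN []      = 0
countN (N ∷ w) = suc (countN w)
countN (E ∷ w) = countN w

InB : ℕ → ℕ → Word → Set
InB p q w = (countE w ≡ p) × (countN w ≡ q)
  where open import Relation.Binary.PropositionalEquality using (_≡_)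

eBeforeN : Word → ℕ → ℕ
eBeforeN []      r       = 0
eBeforeN (E ∷ w) r       = suc (eBeforeN w r)
eBeforeN (N ∷ w) zero    = 0
eBeforeN (N ∷ w) (suc r) = eBeforeN w r

nBeforeE : Word → ℕ → ℕ
nBeforeE []      r       = 0
nBeforeE (N ∷ w) r       = suc (nBeforeE w r)
nBeforeE (E ∷ w) zero    = 0
nBeforeE (E ∷ w) (suc r) = nBeforeE w r

-- In w^ℤ (copy k of w starts at (p k, q k), p = #E, q = #N), the unique
-- north step starting at ordinate i is the r-th N of copy k, where
-- i = q k + r, 0 ≤ r < q; its starting abscissa is p k + #E before it.
-- (Only meaningful when q > 0; the value 0 for q = 0 is never used.)
northAbscissa : Word → ℤ → ℤ
northAbscissa w i with countN w
... | zero   = + 0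
... | suc q' = (+ countE w) * (i /ℕ suc q') + (+ eBeforeN w (i %ℕ suc q'))

-- Symmetrically, ordinate of the unique east step of w^ℤ starting at abscissa j.
-- (Only meaningful when #E > 0; the value for #E = 0 is never used.)
eastOrdinate : Word → ℤ → ℤ
eastOrdinate w j with countE w
... | zero   = + 0
... | suc p' = (+ countN w) * (j /ℕ suc p') + (+ nBeforeE w (j %ℕ suc p'))

-- Configurations on K_{m,n}: (c_1..c_n) and (c_{n+1}..c_{n+m-1}) as two blocks.
Config : ℕ → ℕ → Set
Config m n = Vec ℤ n × Vec ℤ (m ∸ 1)

-- M(u'', ℓ', y) with R = (N u'')^ℤ and G = (E ℓ')^ℤ.
M : (m n : ℕ) → Word → Word → ℤ × ℤ → Config m n
M m n u'' ℓ' (y₁ , y₂) =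
    Vec.tabulate (λ (i : Fin n) → northAbscissa (E ∷ ℓ') (y₂ + + toℕ i) - y₁ - + 1)
  , Vec.tabulate (λ (j : Fin (m ∸ 1)) → eastOrdinate (N ∷ u'') (y₁ + + toℕ j) - y₂ - + 1)

β : (m n : ℕ) → Config m n → Config m n
β m n (a , b) = Vec.map (λ c → + (m ∸ 1) - c) a , Vec.map (λ c → + (n ∸ 1) - c) b

ρc : (m n : ℕ) → Config m n → Config m n
ρc m n (a , b) = Vec.reverse a , Vec.reverse b

ρ : Word → Word
ρ = List.reverse

-- Let w have p letters E and q > 0 letters N.  The north step of w^ℤ at ordinate i starts at
-- abscissa p⌊i/q⌋ + e(i mod q), where e(r) is the number of E's before the r-th N of w.  The r-th N
-- of w is the (q-1-r)-th N of ρ w, and the E's before it there are those after it in w, so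
-- e_w(r) + e_{ρ w}(q-1-r) = p; since i ↦ q-1-i maps periods onto periods, X_w(i) + X_{ρ w}(q-1-i)
-- is constant.  The same holds for the east steps, and β subtracts from exactly these constants,
-- which turns the shift y into -y.
module Submission where

open import Defs
open import Data.Nat using (ℕ; _∸_; NonZero)
open import Data.Integer using (ℤ; -_)
open import Data.Product using (_,_)
open import Relation.Binary.PropositionalEquality using (_≡_)

open import Data.Nat as ℕ using (zero; suc)
import Data.Nat.Properties as ℕ
open import Data.Integer as ℤ using (+_; _+_; _-_; _*_; _<_; _/ℕ_; _%ℕ_; +<+)
open import Data.Integer.Properties
  using (<-cmp; <-irrefl; +-monoˡ-<; suc-*; *-monoʳ-≤-nonNeg; i<j⇒suc[i]≤j; i≤j+i; pos-+;
         +-injective; +-0-abelianGroup; module ≤-Reasoning)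
open import Algebra.Properties.AbelianGroup +-0-abelianGroup using () renaming (∙-cancelʳ to +-cancelʳ)
open import Data.Integer.DivMod using (n%ℕd<d; a≡a%ℕn+[a/ℕn]*n)
open import Data.Integer.Tactic.RingSolver using (solve-∀)
open import Data.List using ([]; _∷_; _ʳ++_)
open import Data.Vec as Vec using (tabulate; _∷ʳ_)
open import Data.Vec.Properties using (reverse-∷; tabulate-∘; tabulate-cong)
open import Data.Fin as Fin using (Fin; toℕ; fromℕ; inject₁)
open import Data.Fin.Properties using (toℕ<n; toℕ-inject₁; toℕ-fromℕ)
open import Data.Product using (_×_; proj₁; proj₂)
open import Data.Empty using (⊥-elim)
open import Function using (_∘_)
open import Relation.Binary.Definitions using (tri<; tri≈; tri>)
open import Relation.Binary.PropositionalEquality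
  using (refl; sym; trans; cong; cong₂; _≗_; module ≡-Reasoning)

countE-ʳ++ : ∀ w v → countE (w ʳ++ v) ≡ countE w ℕ.+ countE v
countE-ʳ++ []      v = refl
countE-ʳ++ (E ∷ w) v = trans (countE-ʳ++ w (E ∷ v)) (ℕ.+-suc (countE w) (countE v))
countE-ʳ++ (N ∷ w) v = countE-ʳ++ w (N ∷ v)

countN-ʳ++ : ∀ w v → countN (w ʳ++ v) ≡ countN w ℕ.+ countN v
countN-ʳ++ []      v = refl
countN-ʳ++ (N ∷ w) v = trans (countN-ʳ++ w (N ∷ v)) (ℕ.+-suc (countN w) (countN v))
countN-ʳ++ (E ∷ w) v = countN-ʳ++ w (E ∷ v)

countE-reverse : ∀ w → countE (ρ w) ≡ countE w
countE-reverse w = trans (countE-ʳ++ w []) (ℕ.+-identityʳ (countE w))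

countN-reverse : ∀ w → countN (ρ w) ≡ countN w
countN-reverse w = trans (countN-ʳ++ w []) (ℕ.+-identityʳ (countN w))

eBeforeN-ʳ++-beyond : ∀ w v s → eBeforeN (w ʳ++ v) (countN w ℕ.+ s) ≡ countE w ℕ.+ eBeforeN v s
eBeforeN-ʳ++-beyond []      v s = refl
eBeforeN-ʳ++-beyond (E ∷ w) v s =
  trans (eBeforeN-ʳ++-beyond w (E ∷ v) s) (ℕ.+-suc (countE w) (eBeforeN v s))
eBeforeN-ʳ++-beyond (N ∷ w) v s =
  trans (cong (eBeforeN (w ʳ++ (N ∷ v))) (sym (ℕ.+-suc (countN w) s)))
        (eBeforeN-ʳ++-beyond w (N ∷ v) (suc s))

nBeforeE-ʳ++-beyond : ∀ w v s → nBeforeE (w ʳ++ v) (countE w ℕ.+ s) ≡ countN w ℕ.+ nBeforeE v s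
nBeforeE-ʳ++-beyond []      v s = refl
nBeforeE-ʳ++-beyond (N ∷ w) v s =
  trans (nBeforeE-ʳ++-beyond w (N ∷ v) s) (ℕ.+-suc (countN w) (nBeforeE v s))
nBeforeE-ʳ++-beyond (E ∷ w) v s =
  trans (cong (nBeforeE (w ʳ++ (E ∷ v))) (sym (ℕ.+-suc (countE w) s)))
        (nBeforeE-ʳ++-beyond w (E ∷ v) (suc s))

eBeforeN-ʳ++ : ∀ w v r s → suc (r ℕ.+ s) ≡ countN w →
  eBeforeN w r ℕ.+ eBeforeN (w ʳ++ v) s ≡ countE w
eBeforeN-ʳ++ (E ∷ w) v r       s eq = cong suc (eBeforeN-ʳ++ w (E ∷ v) r s eq)
eBeforeN-ʳ++ (N ∷ w) v (suc r) s eq = eBeforeN-ʳ++ w (N ∷ v) r s (ℕ.suc-injective eq)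
eBeforeN-ʳ++ (N ∷ w) v zero    s eq = begin
  eBeforeN (w ʳ++ (N ∷ v)) s               ≡⟨ cong (eBeforeN (w ʳ++ (N ∷ v))) s≡countN+0 ⟩
  eBeforeN (w ʳ++ (N ∷ v)) (countN w ℕ.+ 0) ≡⟨ eBeforeN-ʳ++-beyond w (N ∷ v) 0 ⟩
  countE w ℕ.+ 0                            ≡⟨ ℕ.+-identityʳ (countE w) ⟩
  countE w                                  ∎
  where
  open ≡-Reasoning
  s≡countN+0 : s ≡ countN w ℕ.+ 0
  s≡countN+0 = trans (ℕ.suc-injective eq) (sym (ℕ.+-identityʳ (countN w)))

nBeforeE-ʳ++ : ∀ w v r s → suc (r ℕ.+ s) ≡ countE w →
  nBeforeE w r ℕ.+ nBeforeE (w ʳ++ v) s ≡ countN w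
nBeforeE-ʳ++ (N ∷ w) v r       s eq = cong suc (nBeforeE-ʳ++ w (N ∷ v) r s eq)
nBeforeE-ʳ++ (E ∷ w) v (suc r) s eq = nBeforeE-ʳ++ w (E ∷ v) r s (ℕ.suc-injective eq)
nBeforeE-ʳ++ (E ∷ w) v zero    s eq = begin
  nBeforeE (w ʳ++ (E ∷ v)) s               ≡⟨ cong (nBeforeE (w ʳ++ (E ∷ v))) s≡countE+0 ⟩
  nBeforeE (w ʳ++ (E ∷ v)) (countE w ℕ.+ 0) ≡⟨ nBeforeE-ʳ++-beyond w (E ∷ v) 0 ⟩
  countN w ℕ.+ 0                            ≡⟨ ℕ.+-identityʳ (countN w) ⟩
  countN w                                  ∎
  where
  open ≡-Reasoning
  s≡countE+0 : s ≡ countE w ℕ.+ 0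
  s≡countE+0 = trans (ℕ.suc-injective eq) (sym (ℕ.+-identityʳ (countE w)))

pos-m∸n+n≡m : ∀ {m n} → n ℕ.≤ m → + (m ∸ n) + + n ≡ + m
pos-m∸n+n≡m {m} {n} n≤m = trans (sym (pos-+ (m ∸ n) n)) (cong +_ (ℕ.m∸n+n≡m n≤m))

quotient-<⇒< : ∀ {d r r′ b b′} → r ℕ.< d → b < b′ → + r + b * + d < + r′ + b′ * + d
quotient-<⇒< {d} {r} {r′} {b} {b′} r<d b<b′ = begin-strict
  + r + b * + d         <⟨ +-monoˡ-< (b * + d) (+<+ r<d) ⟩
  + d + b * + d         ≡⟨ suc-* b (+ d) ⟨
  ℤ.suc b * + d         ≤⟨ *-monoʳ-≤-nonNeg (+ d) (i<j⇒suc[i]≤j b<b′) ⟩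
  b′ * + d              ≤⟨ i≤j+i (b′ * + d) (+ r′) ⟩
  + r′ + b′ * + d       ∎
  where open ≤-Reasoning

divModℕ-unique : ∀ {d r r′ b b′} → r ℕ.< d → r′ ℕ.< d →
  + r + b * + d ≡ + r′ + b′ * + d → b ≡ b′ × r ≡ r′
divModℕ-unique {d} {r} {r′} {b} {b′} r<d r′<d eq with <-cmp b b′
... | tri< b<b′ _ _ = ⊥-elim (<-irrefl eq (quotient-<⇒< r<d b<b′))
... | tri> _ _ b′<b = ⊥-elim (<-irrefl (sym eq) (quotient-<⇒< r′<d b′<b))
... | tri≈ _ refl _ = refl , +-injective (+-cancelʳ (b * + d) (+ r) (+ r′) eq)

staircase : (e d : ℕ) → (ℕ → ℕ) → ℤ → ℤ
staircase e d f i = + e * (i /ℕ suc d) + + f (i %ℕ suc d)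

staircase-period : ∀ e d f b {r} → r ℕ.≤ d →
  staircase e d f (+ r + b * + suc d) ≡ + e * b + + f r
staircase-period e d f b {r} r≤d =
  cong₂ (λ b′ r′ → + e * b′ + + f r′) (sym (proj₁ unique)) (sym (proj₂ unique))
  where
  i : ℤ
  i = + r + b * + suc d
  unique : b ≡ i /ℕ suc d × r ≡ i %ℕ suc d
  unique = divModℕ-unique (ℕ.s≤s r≤d) (n%ℕd<d i (suc d)) (a≡a%ℕn+[a/ℕn]*n i (suc d))

staircase-reflect : ∀ e d f g k → (∀ r → r ℕ.≤ d → f r ℕ.+ g (d ∸ r) ≡ k) →
  ∀ i → staircase e d f i + staircase e d g (+ d - i) ≡ + k
staircase-reflect e d f g k sum i = begin
  staircase e d f i + staircase e d g (+ d - i)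
    ≡⟨ cong (λ j → staircase e d f i + staircase e d g j) reflected ⟩
  + e * b + + f r + staircase e d g (+ (d ∸ r) + (- b) * + suc d)
    ≡⟨ cong (_+_ (+ e * b + + f r)) (staircase-period e d g (- b) (ℕ.m∸n≤m d r)) ⟩
  + e * b + + f r + (+ e * (- b) + + g (d ∸ r))
    ≡⟨ opposite-quotients-cancel (+ e) b (+ f r) (+ g (d ∸ r)) ⟩
  + f r + + g (d ∸ r)
    ≡⟨ pos-+ (f r) (g (d ∸ r)) ⟨
  + (f r ℕ.+ g (d ∸ r))
    ≡⟨ cong +_ (sum r r≤d) ⟩
  + k ∎
  where
  open ≡-Reasoning
  r : ℕ
  r = i %ℕ suc d
  b : ℤ
  b = i /ℕ suc d
  r≤d : r ℕ.≤ d
  r≤d = ℕ.≤-pred (n%ℕd<d i (suc d))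
  opposite-quotients-cancel : ∀ E B F G → E * B + F + (E * (- B) + G) ≡ F + G
  opposite-quotients-cancel = solve-∀
  shift-remainder : ∀ X R B D → X + R - (R + B * D) ≡ X + (- B) * D
  shift-remainder = solve-∀
  reflected : + d - i ≡ + (d ∸ r) + (- b) * + suc d
  reflected = begin
    + d - i
      ≡⟨ cong₂ _-_ (sym (pos-m∸n+n≡m r≤d)) (a≡a%ℕn+[a/ℕn]*n i (suc d)) ⟩
    + (d ∸ r) + + r - (+ r + b * + suc d)
      ≡⟨ shift-remainder (+ (d ∸ r)) (+ r) b (+ suc d) ⟩
    + (d ∸ r) + (- b) * + suc d ∎

northAbscissa-staircase : ∀ w {e d} → countE w ≡ e → countN w ≡ suc d →
  northAbscissa w ≗ staircase e d (eBeforeN w)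
northAbscissa-staircase w refl countN≡ i with countN w | countN≡
... | _ | refl = refl

eastOrdinate-staircase : ∀ w {e d} → countN w ≡ e → countE w ≡ suc d →
  eastOrdinate w ≗ staircase e d (nBeforeE w)
eastOrdinate-staircase w refl countE≡ j with countE w | countE≡
... | _ | refl = refl

northAbscissa-reflect : ∀ w {c d} → countE w ≡ c → countN w ≡ suc d →
  ∀ i → northAbscissa (E ∷ w) i + northAbscissa (E ∷ ρ w) (+ d - i) ≡ + (2 ℕ.+ c)
northAbscissa-reflect w {c} {d} refl countN≡ i = begin
  northAbscissa (E ∷ w) i + northAbscissa (E ∷ ρ w) (+ d - i)
    ≡⟨ cong₂ _+_ (northAbscissa-staircase (E ∷ w) refl countN≡ i)
                 (northAbscissa-staircase (E ∷ ρ w) (cong suc (countE-reverse w))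
                    (trans (countN-reverse w) countN≡) (+ d - i)) ⟩
  staircase (suc c) d (suc ∘ eBeforeN w) i + staircase (suc c) d (suc ∘ eBeforeN (ρ w)) (+ d - i)
    ≡⟨ staircase-reflect (suc c) d (suc ∘ eBeforeN w) (suc ∘ eBeforeN (ρ w)) (2 ℕ.+ c) sum i ⟩
  + (2 ℕ.+ c) ∎
  where
  open ≡-Reasoning
  sum : ∀ r → r ℕ.≤ d → suc (eBeforeN w r) ℕ.+ suc (eBeforeN (ρ w) (d ∸ r)) ≡ 2 ℕ.+ c
  sum r r≤d = cong suc (trans (ℕ.+-suc _ _) (cong suc
    (eBeforeN-ʳ++ w [] r (d ∸ r) (trans (cong suc (ℕ.m+[n∸m]≡n r≤d)) (sym countN≡)))))

eastOrdinate-reflect : ∀ w {c d} → countN w ≡ c → countE w ≡ suc d →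
  ∀ j → eastOrdinate (N ∷ w) j + eastOrdinate (N ∷ ρ w) (+ d - j) ≡ + (2 ℕ.+ c)
eastOrdinate-reflect w {c} {d} refl countE≡ j = begin
  eastOrdinate (N ∷ w) j + eastOrdinate (N ∷ ρ w) (+ d - j)
    ≡⟨ cong₂ _+_ (eastOrdinate-staircase (N ∷ w) refl countE≡ j)
                 (eastOrdinate-staircase (N ∷ ρ w) (cong suc (countN-reverse w))
                    (trans (countE-reverse w) countE≡) (+ d - j)) ⟩
  staircase (suc c) d (suc ∘ nBeforeE w) j + staircase (suc c) d (suc ∘ nBeforeE (ρ w)) (+ d - j)
    ≡⟨ staircase-reflect (suc c) d (suc ∘ nBeforeE w) (suc ∘ nBeforeE (ρ w)) (2 ℕ.+ c) sum j ⟩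
  + (2 ℕ.+ c) ∎
  where
  open ≡-Reasoning
  sum : ∀ r → r ℕ.≤ d → suc (nBeforeE w r) ℕ.+ suc (nBeforeE (ρ w) (d ∸ r)) ≡ 2 ℕ.+ c
  sum r r≤d = cong suc (trans (ℕ.+-suc _ _) (cong suc
    (nBeforeE-ʳ++ w [] r (d ∸ r) (trans (cong suc (ℕ.m+[n∸m]≡n r≤d)) (sym countE≡)))))

tabulate-∷ʳ : ∀ {A : Set} n (f : Fin (suc n) → A) → tabulate f ≡ tabulate (f ∘ inject₁) ∷ʳ f (fromℕ n)
tabulate-∷ʳ zero    f = refl
tabulate-∷ʳ (suc n) f = cong (f Fin.zero Vec.∷_) (tabulate-∷ʳ n (f ∘ Fin.suc))

reverse-tabulate : ∀ {A : Set} n (K : ℕ → A) →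
  Vec.reverse (tabulate {n = n} (K ∘ toℕ)) ≡ tabulate (λ i → K (n ∸ suc (toℕ i)))
reverse-tabulate zero    K = refl
reverse-tabulate (suc n) K = begin
  Vec.reverse (K 0 Vec.∷ tabulate (K ∘ suc ∘ toℕ))
    ≡⟨ reverse-∷ (K 0) (tabulate (K ∘ suc ∘ toℕ)) ⟩
  Vec.reverse (tabulate (K ∘ suc ∘ toℕ)) ∷ʳ K 0
    ≡⟨ cong (_∷ʳ K 0) (reverse-tabulate n (K ∘ suc)) ⟩
  tabulate (λ i → K (suc (n ∸ suc (toℕ i)))) ∷ʳ K 0
    ≡⟨ cong₂ _∷ʳ_ (tabulate-cong λ i → cong K (trans (sym (ℕ.+-∸-assoc 1 (toℕ<n i)))
                                                    (cong (n ∸_) (sym (toℕ-inject₁ i)))))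
                  (cong K (sym (trans (cong (n ∸_) (toℕ-fromℕ n)) (ℕ.n∸n≡0 n)))) ⟩
  tabulate (λ i → K (n ∸ toℕ (inject₁ i))) ∷ʳ K (n ∸ toℕ (fromℕ n))
    ≡⟨ tabulate-∷ʳ n (λ i → K (n ∸ toℕ i)) ⟨
  tabulate (λ i → K (n ∸ toℕ i)) ∎
  where open ≡-Reasoning

β-entry : ∀ c a a′ x → a + a′ ≡ + (2 ℕ.+ c) → + c - (a - x - + 1) ≡ a′ - - x - + 1
β-entry c a a′ x a+a′≡2+c = begin
  + c - (a - x - + 1)
    ≡⟨ add-two (+ c) a x ⟩
  + 2 + + c - a - - x - + 1
    ≡⟨ cong (λ s → s - a - - x - + 1) (trans (sym (pos-+ 2 c)) (sym a+a′≡2+c)) ⟩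
  a + a′ - a - - x - + 1
    ≡⟨ cancel a a′ x ⟩
  a′ - - x - + 1 ∎
  where
  open ≡-Reasoning
  add-two : ∀ C A X → C - (A - X - + 1) ≡ + 2 + C - A - - X - + 1
  add-two = solve-∀
  cancel : ∀ A A′ X → A + A′ - A - - X - + 1 ≡ A′ - - X - + 1
  cancel = solve-∀

-- Quantifying over d with n = suc d lets the empty block go through without a hypothesis.
tabulate-reflect : ∀ {n c} (A A′ : ℤ → ℤ) (x y : ℤ) →
  (∀ {d} → n ≡ suc d → ∀ i → A i + A′ (+ d - i) ≡ + (2 ℕ.+ c)) →
  Vec.reverse (Vec.map (λ v → + c - v) (tabulate {n = n} (λ j → A (y + + toℕ j) - x - + 1)))
    ≡ tabulate (λ j → A′ (- y + + toℕ j) - - x - + 1)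
tabulate-reflect {zero}      A A′ x y reflect = refl
tabulate-reflect {suc d} {c} A A′ x y reflect = begin
  Vec.reverse (Vec.map (_-_ (+ c)) (tabulate (K ∘ toℕ)))
    ≡⟨ cong Vec.reverse (tabulate-∘ (_-_ (+ c)) (K ∘ toℕ)) ⟨
  Vec.reverse (tabulate ((_-_ (+ c)) ∘ K ∘ toℕ))
    ≡⟨ reverse-tabulate (suc d) ((_-_ (+ c)) ∘ K) ⟩
  tabulate (λ j → + c - K (d ∸ toℕ j))
    ≡⟨ tabulate-cong (λ j → entry (toℕ j) (ℕ.≤-pred (toℕ<n j))) ⟩
  tabulate (λ j → A′ (- y + + toℕ j) - - x - + 1) ∎
  where
  open ≡-Reasoning
  K : ℕ → ℤ
  K t = A (y + + t) - x - + 1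
  mirror : ∀ Y X T → X + T - (Y + X) ≡ - Y + T
  mirror = solve-∀
  entry : ∀ t → t ℕ.≤ d → + c - K (d ∸ t) ≡ A′ (- y + + t) - - x - + 1
  entry t t≤d = trans (β-entry c (A i) (A′ (+ d - i)) x (reflect refl i))
    (cong (λ k → A′ k - - x - + 1) (begin
      + d - i             ≡⟨ cong (_- i) (sym (pos-m∸n+n≡m t≤d)) ⟩
      + (d ∸ t) + + t - i ≡⟨ mirror y (+ (d ∸ t)) (+ t) ⟩
      - y + + t           ∎))
    where
    i : ℤ
    i = y + + (d ∸ t)

lemma5p14 : (m n : ℕ) → .{{NonZero m}} → .{{NonZero n}} →
    (u'' ℓ' : Word) → InB (m ∸ 1) (n ∸ 1) u'' → InB (m ∸ 1) n ℓ' →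
    (y₁ y₂ : ℤ) →
    ρc m n (β m n (M m n u'' ℓ' (y₁ , y₂))) ≡ M m n (ρ u'') (ρ ℓ') (- y₁ , - y₂)
lemma5p14 (suc p) (suc q) u ℓ (countE-u , countN-u) (countE-ℓ , countN-ℓ) y₁ y₂ =
  cong₂ _,_
    (tabulate-reflect (northAbscissa (E ∷ ℓ)) (northAbscissa (E ∷ ρ ℓ)) y₁ y₂
      (λ 1+q≡1+d → northAbscissa-reflect ℓ countE-ℓ (trans countN-ℓ 1+q≡1+d)))
    (tabulate-reflect (eastOrdinate (N ∷ u)) (eastOrdinate (N ∷ ρ u)) y₂ y₁
      (λ p≡1+d → eastOrdinate-reflect u countN-u (trans countE-u p≡1+d)))
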